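{- Every flow-admissible signed Möbius ladder $ML_4$ and every flow-admissible signed Möbius ladder $ML_5$ admits a nowhere-zero $5$-flow.
   Context: The Möbius ladder $ML_n$ (of order $2n$) is obtained from a cycle $w_1w_2\cdots w_{2n}w_1$ by adding the chords $w_jw_{j+n}$ for $j=1,\dots,n$; a signed Möbius ladder carries a sign $+$ or $-$ on each edge. An orientation of a signed graph splits each edge into two half-edges; a positive edge has one half-edge directed away from and one towards its end-vertex, a negative edge has both half-edges directed towards, or both away from, their end-vertices. A nowhere-zero $k$-flow is an orientation with values from $\{\pm1,\dots,\pm(k-1)\}$ on the edges such that at every vertex the sum of incoming values equals the sum of outgoing values. A signed graph is flow-admissible if it admits a nowhere-zero $k$-flow for some $k$. -}

module Defs where

open import Data.Nat as ℕ using (ℕ; suc; _+_; _%_)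
open import Data.Fin using (Fin; toℕ)

open import Data.Integer as ℤ using (ℤ; +_; -_; ∣_∣)
open import Data.Bool using (Bool; true; false; if_then_else_)
open import Data.List using (List; map; _++_; foldr; allFin)
open import Data.Sum using (_⊎_; inj₁; inj₂)
open import Data.Product using (_×_; Σ; ∃)
open import Relation.Binary.PropositionalEquality using (_≡_; _≢_)
open import Relation.Nullary using (Dec; yes; no)

-- Möbius ladder ML_n with n = suc m, vertices w_1..w_{2n} represented by
-- 0..2n-1 (i.e. Fin (n + n)); vertex index i corresponds to w_{i+1}.
-- Edges: inj₁ j  (j < 2n) is the cycle edge w_{j+1} w_{j+2 mod 2n};
--        inj₂ j  (j < n)  is the chord     w_{j+1} w_{j+1+n}.
Edge : ℕ → Set
Edge m = Fin (suc m + suc m) ⊎ Fin (suc m)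

allEdges : (m : ℕ) → List (Edge m)
allEdges m = map inj₁ (allFin (suc m + suc m)) ++ map inj₂ (allFin (suc m))

end₁ : (m : ℕ) → Edge m → ℕ
end₁ m (inj₁ j) = toℕ j
end₁ m (inj₂ j) = toℕ j

end₂ : (m : ℕ) → Edge m → ℕ
end₂ m (inj₁ j) = (suc (toℕ j)) % (suc m + suc m)
end₂ m (inj₂ j) = toℕ j + suc m

data Sign : Set where
  pos neg : Sign

Signature : ℕ → Set
Signature m = Edge m → Sign

-- An orientation assigns to each of the two half-edges of each edge a
-- direction: true = directed away from its end-vertex, false = towards it.
record Orientation (m : ℕ) (σ : Signature m) : Set where
  field
    dir₁ dir₂ : Edge m → Bool
    compatible : ∀ e → (σ e ≡ pos → dir₁ e ≢ dir₂ e) × (σ e ≡ neg → dir₁ e ≡ dir₂ e)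

contrib : Bool → ℕ → ℕ → ℤ → ℤ
contrib d u v x with u ℕ.≟ v
... | no _ = + 0
... | yes _ = if d then x else - x

netOut : (m : ℕ) {σ : Signature m} → Orientation m σ → (Edge m → ℤ) → ℕ → ℤ
netOut m τ f v =
  foldr ℤ._+_ (+ 0) (map (λ e → contrib (Orientation.dir₁ τ e) (end₁ m e) v (f e)
                 ℤ.+ contrib (Orientation.dir₂ τ e) (end₂ m e) v (f e))
           (allEdges m))

record NZFlow (k m : ℕ) (σ : Signature m) : Set where
  field
    orientation : Orientation m σ
    value : Edge m → ℤ
    nonzero : ∀ e → value e ≢ + 0
    bounded : ∀ e → ∣ value e ∣ ℕ.< k
    conservation : (v : Fin (suc m + suc m)) → netOut m orientation value (toℕ v) ≡ + 0

FlowAdmissible : (m : ℕ) → Signature m → Set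
FlowAdmissible m σ = Σ ℕ (λ k → NZFlow k m σ)

{-# OPTIONS --safe #-}
module Submission where

-- Switching at a set of vertices (reversing every half-edge there) turns nowhere-zero k-flows into
-- nowhere-zero k-flows, and switching at every w_{v+1} for which the path w_1 ⋯ w_{v+1} carries an odd
-- number of negative edges makes all cycle edges except w_{2n}w_1 positive.  So it suffices to treat the
-- 2^{n+1} signatures determined by the signs of w_{2n}w_1 and of the n chords.  Each of them either gets
-- an explicit 5-flow, checked by evaluation, or becomes a signed graph with exactly one negative edge
-- after switching at some {w_1, …, w_t}; the latter has no nowhere-zero flow at all, since summing the
-- conservation laws over all vertices cancels every positive edge and leaves ±2f(e) for the negative
-- edge e.

open import Defs
open import Agda.Builtin.FromNat using (Number; fromNat)
open import Agda.Builtin.FromNeg using (Negative)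
open import Algebra using (CommutativeRing)
open import Data.Bool using (Bool; true; false; _xor_; if_then_else_)
open import Data.Bool.Properties using (not-involutive; xor-same; xor-∧-commutativeRing)
open import Data.Empty using (⊥-elim)
open import Data.Fin as Fin using (Fin; toℕ; fromℕ; fromℕ<)
open import Data.Fin.Properties as Finₚ using (toℕ-injective; toℕ<n; toℕ≤pred[n]; toℕ-fromℕ; toℕ-fromℕ<)
open import Data.Integer as ℤ using (ℤ; _+_; -_; -[1+_]; ∣_∣)
import Data.Integer.Literals as ℤ-Literals
import Data.Integer.Properties as ℤₚ
open import Data.List using (List; []; _∷_; map; foldr; filter; downFrom)
open import Data.List.Membership.Propositional.Properties using (∈-filter⁻)
open import Data.List.Relation.Unary.Any using (here)
open import Data.List.Membership.Propositional using (_∈_)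
open import Data.Nat as ℕ using (ℕ; zero; suc; _<_; _<ᵇ_; _%_; NonZero)
import Data.Nat.Literals as ℕ-Literals
import Data.Nat.Properties as ℕₚ
open import Data.Nat.DivMod using (_mod_; m%n<n; m<n⇒m%n≡m)
open import Data.Product using (_×_; _,_; proj₁; proj₂)
open import Data.Sum using (_⊎_; inj₁; inj₂; [_,_])
open import Data.Unit using (tt)
open import Data.Vec using (Vec; []; _∷_; lookup; tabulate)
open import Data.Vec.Properties using (lookup∘tabulate)
open import Function using (_∘_)
open import Relation.Binary.PropositionalEquality using (_≡_; _≢_; refl; sym; trans; cong; cong₂; subst; _≗_; module ≡-Reasoning)
open import Relation.Nullary using (Dec; yes; no; ¬_; does)
open import Relation.Nullary.Decidable using (True; toWitness; map′; ¬?; _×-dec_)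
open import Relation.Unary using (Decidable)

open import Algebra.Properties.CommutativeSemigroup ℤₚ.+-commutativeSemigroup using () renaming (interchange to +-interchange)
open import Algebra.Properties.CommutativeSemigroup (CommutativeRing.+-commutativeSemigroup xor-∧-commutativeRing) using () renaming (interchange to xor-interchange)

instance
  ℕ-number : Number ℕ
  ℕ-number = ℕ-Literals.number
  ℤ-number : Number ℤ
  ℤ-number = ℤ-Literals.number
  ℤ-negative : Negative ℤ
  ℤ-negative = ℤ-Literals.negative

sumBy : {A : Set} → (A → ℤ) → List A → ℤ
sumBy g xs = foldr _+_ 0 (map g xs)

module _ {A : Set} where

  sumBy-cong : {g h : A → ℤ} → (∀ x → g x ≡ h x) → ∀ xs → sumBy g xs ≡ sumBy h xs
  sumBy-cong g≗h []       = refl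
  sumBy-cong g≗h (x ∷ xs) = cong₂ _+_ (g≗h x) (sumBy-cong g≗h xs)

  sumBy-zero : ∀ xs → sumBy {A} (λ _ → 0) xs ≡ 0
  sumBy-zero []       = refl
  sumBy-zero (x ∷ xs) = trans (ℤₚ.+-identityˡ _) (sumBy-zero xs)

  sumBy-+ : ∀ (g h : A → ℤ) xs → sumBy (λ x → g x + h x) xs ≡ sumBy g xs + sumBy h xs
  sumBy-+ g h []       = refl
  sumBy-+ g h (x ∷ xs) =
    trans (cong ((g x + h x) +_) (sumBy-+ g h xs)) (+-interchange (g x) (h x) (sumBy g xs) (sumBy h xs))

  sumBy-neg : ∀ (g : A → ℤ) xs → sumBy (λ x → - g x) xs ≡ - sumBy g xs
  sumBy-neg g []       = refl
  sumBy-neg g (x ∷ xs) = trans (cong (- g x +_) (sumBy-neg g xs)) (sym (ℤₚ.neg-distrib-+ (g x) (sumBy g xs)))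

  sumBy-filter : {P : A → Set} (P? : Decidable P) (g : A → ℤ) →
                 (∀ x → ¬ P x → g x ≡ 0) → ∀ xs → sumBy g xs ≡ sumBy g (filter P? xs)
  sumBy-filter P? g g≡0 []       = refl
  sumBy-filter P? g g≡0 (x ∷ xs) with P? x
  ... | yes _  = cong (g x +_) (sumBy-filter P? g g≡0 xs)
  ... | no ¬Px = trans (cong₂ _+_ (g≡0 x ¬Px) (sumBy-filter P? g g≡0 xs)) (ℤₚ.+-identityˡ _)

sumBy-comm : {A B : Set} (k : A → B → ℤ) (xs : List A) (ys : List B) →
             sumBy (λ y → sumBy (λ x → k x y) xs) ys ≡ sumBy (λ x → sumBy (k x) ys) xs
sumBy-comm k xs []       = sym (sumBy-zero xs)
sumBy-comm k xs (y ∷ ys) =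
  trans (cong (sumBy (λ x → k x y) xs +_) (sumBy-comm k xs ys))
        (sym (sumBy-+ (λ x → k x y) (λ x → sumBy (k x) ys) xs))

sumBy-downFrom-zero : ∀ {g : ℕ → ℤ} n → (∀ v → v < n → g v ≡ 0) → sumBy g (downFrom n) ≡ 0
sumBy-downFrom-zero zero    _   = refl
sumBy-downFrom-zero (suc n) g≡0 =
  cong₂ _+_ (g≡0 n ℕₚ.≤-refl) (sumBy-downFrom-zero n (λ v v<n → g≡0 v (ℕₚ.m≤n⇒m≤1+n v<n)))

sumBy-downFrom-single : ∀ {g : ℕ → ℤ} {u} n → u < n → (∀ v → v ≢ u → g v ≡ 0) → sumBy g (downFrom n) ≡ g u
sumBy-downFrom-single {g} {u} (suc n) u<1+n g≡0 with u ℕ.≟ n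
... | yes refl = trans (cong (g u +_) (sumBy-downFrom-zero n (λ v v<u → g≡0 v (ℕₚ.<⇒≢ v<u))))
                       (ℤₚ.+-identityʳ (g u))
... | no u≢n   = trans (cong₂ _+_ (g≡0 n (u≢n ∘ sym))
                                    (sumBy-downFrom-single n (ℕₚ.≤∧≢⇒< (ℕₚ.≤-pred u<1+n) u≢n) g≡0))
                       (ℤₚ.+-identityˡ (g u))

flip : Sign → Sign
flip pos = neg
flip neg = pos

flipIf : Bool → Sign → Sign
flipIf b x = if b then flip x else x

flipIf-involutive : ∀ b x → flipIf b (flipIf b x) ≡ x
flipIf-involutive false x   = refl
flipIf-involutive true  pos = refl
flipIf-involutive true  neg = refl

negative? : (x : Sign) → Dec (x ≡ neg)
negative? pos = no λ ()
negative? neg = yes refl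

flipIf-negative : ∀ x → flipIf (does (negative? x)) x ≡ pos
flipIf-negative pos = refl
flipIf-negative neg = refl

isPositive : Sign → Bool
isPositive pos = true
isPositive neg = false

isPositive-flipIf : ∀ b x → isPositive (flipIf b x) ≡ isPositive x xor b
isPositive-flipIf false pos = refl
isPositive-flipIf false neg = refl
isPositive-flipIf true  pos = refl
isPositive-flipIf true  neg = refl

xor-cancelˡ : ∀ a b → a xor (a xor b) ≡ b
xor-cancelˡ false b = refl
xor-cancelˡ true  b = not-involutive b

Compatible : Sign → Bool → Bool → Set
Compatible x d₁ d₂ = (x ≡ pos → d₁ ≢ d₂) × (x ≡ neg → d₁ ≡ d₂)

compatible⇒xor : ∀ x d₁ d₂ → Compatible x d₁ d₂ → d₁ xor d₂ ≡ isPositive x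
compatible⇒xor pos true  true  (≢ , _) = ⊥-elim (≢ refl refl)
compatible⇒xor pos true  false _       = refl
compatible⇒xor pos false true  _       = refl
compatible⇒xor pos false false (≢ , _) = ⊥-elim (≢ refl refl)
compatible⇒xor neg d₁    d₂    (_ , ≡) with refl ← ≡ refl = xor-same d₁

xor⇒compatible : ∀ x d₁ d₂ → d₁ xor d₂ ≡ isPositive x → Compatible x d₁ d₂
xor⇒compatible pos true  false _ = (λ _ ()) , (λ ())
xor⇒compatible pos false true  _ = (λ _ ()) , (λ ())
xor⇒compatible neg true  true  _ = (λ ()) , (λ _ → refl)
xor⇒compatible neg false false _ = (λ ()) , (λ _ → refl)
xor⇒compatible pos true  true  ()
xor⇒compatible pos false false ()
xor⇒compatible neg true  false ()
xor⇒compatible neg false true  ()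

compatible-switch : ∀ x d₁ d₂ a b → Compatible x d₁ d₂ → Compatible (flipIf (a xor b) x) (d₁ xor a) (d₂ xor b)
compatible-switch x d₁ d₂ a b c = xor⇒compatible _ _ _ (begin
  (d₁ xor a) xor (d₂ xor b)   ≡⟨ xor-interchange d₁ a d₂ b ⟩
  (d₁ xor d₂) xor (a xor b)   ≡⟨ cong (_xor (a xor b)) (compatible⇒xor x d₁ d₂ c) ⟩
  isPositive x xor (a xor b)  ≡⟨ isPositive-flipIf (a xor b) x ⟨
  isPositive (flipIf (a xor b) x) ∎)
  where open ≡-Reasoning

halfEdgeValue : Bool → ℤ → ℤ
halfEdgeValue d x = if d then x else - x

opposite-halfEdgeValues : ∀ d₁ d₂ x → d₁ ≢ d₂ → halfEdgeValue d₁ x + halfEdgeValue d₂ x ≡ 0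
opposite-halfEdgeValues true  true  x d₁≢d₂ = ⊥-elim (d₁≢d₂ refl)
opposite-halfEdgeValues true  false x _     = ℤₚ.+-inverseʳ x
opposite-halfEdgeValues false true  x _     = ℤₚ.+-inverseˡ x
opposite-halfEdgeValues false false x d₁≢d₂ = ⊥-elim (d₁≢d₂ refl)

x+x≡0⇒x≡0 : ∀ x → x + x ≡ 0 → x ≡ 0
x+x≡0⇒x≡0 (ℤ.+ zero) _ = refl
x+x≡0⇒x≡0 (ℤ.+ suc n) ()
x+x≡0⇒x≡0 -[1+ n ] ()

equal-halfEdgeValues : ∀ d x → halfEdgeValue d x + halfEdgeValue d x ≡ 0 → x ≡ 0
equal-halfEdgeValues true  x sum≡0 = x+x≡0⇒x≡0 x sum≡0
equal-halfEdgeValues false x sum≡0 = ℤₚ.neg-injective (x+x≡0⇒x≡0 (- x) sum≡0)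

contrib-self : ∀ d u x → contrib d u u x ≡ halfEdgeValue d x
contrib-self d u x with u ℕ.≟ u
... | yes _   = refl
... | no u≢u = ⊥-elim (u≢u refl)

contrib-other : ∀ d u v x → u ≢ v → contrib d u v x ≡ 0
contrib-other d u v x u≢v with u ℕ.≟ v
... | yes u≡v = ⊥-elim (u≢v u≡v)
... | no _    = refl

sumBy-contrib : ∀ d u x n → u < n → sumBy (λ v → contrib d u v x) (downFrom n) ≡ halfEdgeValue d x
sumBy-contrib d u x n u<n =
  trans (sumBy-downFrom-single n u<n (λ v v≢u → contrib-other d u v x (v≢u ∘ sym))) (contrib-self d u x)

negateIf : Bool → ℤ → ℤ
negateIf b x = if b then - x else x

negateIf-zero : ∀ b → negateIf b 0 ≡ 0
negateIf-zero false = refl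
negateIf-zero true  = refl

negateIf-+ : ∀ b x y → negateIf b x + negateIf b y ≡ negateIf b (x + y)
negateIf-+ false x y = refl
negateIf-+ true  x y = sym (ℤₚ.neg-distrib-+ x y)

sumBy-negateIf : {A : Set} (b : Bool) (g : A → ℤ) (xs : List A) → sumBy (λ x → negateIf b (g x)) xs ≡ negateIf b (sumBy g xs)
sumBy-negateIf false g xs = refl
sumBy-negateIf true  g xs = sumBy-neg g xs

contrib-xor : ∀ (s : ℕ → Bool) d u v x → contrib (d xor s u) u v x ≡ negateIf (s v) (contrib d u v x)
contrib-xor s d u v x with u ℕ.≟ v
... | no _     = sym (negateIf-zero (s v))
... | yes refl with d | s u
...   | true  | true  = refl
...   | true  | false = refl
...   | false | true  = sym (ℤₚ.neg-involutive x)
...   | false | false = refl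

toℕ-mod : ∀ {n} .{{_ : NonZero n}} (i : Fin n) → toℕ i mod n ≡ i
toℕ-mod {n} i = toℕ-injective (trans (toℕ-fromℕ< (m%n<n (toℕ i) n)) (m<n⇒m%n≡m (toℕ<n i)))

≢fromℕ⇒toℕ< : ∀ {n} (i : Fin (suc n)) → i ≢ fromℕ n → toℕ i < n
≢fromℕ⇒toℕ< {n} i i≢n = ℕₚ.≤∧≢⇒< (toℕ≤pred[n] i) (λ toℕi≡n → i≢n (toℕ-injective (trans toℕi≡n (sym (toℕ-fromℕ n)))))

order : ℕ → ℕ
order m = suc m ℕ.+ suc m

NZFlowOrInadmissible : ℕ → (m : ℕ) → Signature m → Set
NZFlowOrInadmissible k m σ = NZFlow k m σ ⊎ ¬ FlowAdmissible m σ

module _ {m : ℕ} where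

  end₁<order : ∀ e → end₁ m e < order m
  end₁<order (inj₁ j) = toℕ<n j
  end₁<order (inj₂ j) = ℕₚ.<-≤-trans (toℕ<n j) (ℕₚ.m≤m+n (suc m) (suc m))

  end₂<order : ∀ e → end₂ m e < order m
  end₂<order (inj₁ j) = m%n<n (suc (toℕ j)) (order m)
  end₂<order (inj₂ j) = ℕₚ.+-monoˡ-< (suc m) (toℕ<n j)

  NZFlow-resp-≗ : ∀ {k σ ρ} → σ ≗ ρ → NZFlow k m σ → NZFlow k m ρ
  NZFlow-resp-≗ σ≗ρ F = record
    { orientation = record
      { dir₁ = dir₁
      ; dir₂ = dir₂
      ; compatible = λ e → subst (λ x → Compatible x (dir₁ e) (dir₂ e)) (σ≗ρ e) (compatible e) }
    ; value = value
    ; nonzero = nonzero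
    ; bounded = bounded
    ; conservation = conservation }
    where
    open NZFlow F
    open Orientation orientation

  switch : (ℕ → Bool) → Signature m → Signature m
  switch s σ e = flipIf (s (end₁ m e) xor s (end₂ m e)) (σ e)

  switchOrientation : ∀ {σ} (s : ℕ → Bool) → Orientation m σ → Orientation m (switch s σ)
  switchOrientation s τ = record
    { dir₁ = λ e → dir₁ e xor s (end₁ m e)
    ; dir₂ = λ e → dir₂ e xor s (end₂ m e)
    ; compatible = λ e → compatible-switch _ (dir₁ e) (dir₂ e) (s (end₁ m e)) (s (end₂ m e)) (compatible e) }
    where open Orientation τ

  netOut-switch : ∀ {σ} s (τ : Orientation m σ) f v →
                  netOut m (switchOrientation s τ) f v ≡ negateIf (s v) (netOut m τ f v)
  netOut-switch s τ f v =
    trans (sumBy-cong (λ e → trans (cong₂ _+_ (contrib-xor s (dir₁ e) (end₁ m e) v (f e))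
                                              (contrib-xor s (dir₂ e) (end₂ m e) v (f e)))
                                   (negateIf-+ (s v) _ _))
                      (allEdges m))
          (sumBy-negateIf (s v) _ (allEdges m))
    where open Orientation τ

  switchFlow : ∀ {k σ} (s : ℕ → Bool) → NZFlow k m σ → NZFlow k m (switch s σ)
  switchFlow s F = record
    { orientation = switchOrientation s orientation
    ; value = value
    ; nonzero = nonzero
    ; bounded = bounded
    ; conservation = λ v → begin
        netOut m (switchOrientation s orientation) value (toℕ v) ≡⟨ netOut-switch s orientation value (toℕ v) ⟩
        negateIf (s (toℕ v)) (netOut m orientation value (toℕ v)) ≡⟨ cong (negateIf (s (toℕ v))) (conservation v) ⟩
        negateIf (s (toℕ v)) 0                                     ≡⟨ negateIf-zero (s (toℕ v)) ⟩
        0                                                          ∎ }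
    where
    open NZFlow F
    open ≡-Reasoning

  unswitchFlow : ∀ {k σ} (s : ℕ → Bool) → NZFlow k m (switch s σ) → NZFlow k m σ
  unswitchFlow {σ = σ} s F =
    NZFlow-resp-≗ (λ e → flipIf-involutive (s (end₁ m e) xor s (end₂ m e)) (σ e)) (switchFlow s F)

  excess : ∀ {σ} → Orientation m σ → (Edge m → ℤ) → Edge m → ℤ
  excess τ f e = halfEdgeValue (Orientation.dir₁ τ e) (f e) + halfEdgeValue (Orientation.dir₂ τ e) (f e)

  handshake : ∀ {σ} (τ : Orientation m σ) f → sumBy (excess τ f) (allEdges m) ≡ sumBy (netOut m τ f) (downFrom (order m))
  handshake τ f = begin
    sumBy (excess τ f) (allEdges m)
      ≡⟨ sumBy-cong (λ e → cong₂ _+_ (sumBy-contrib (dir₁ e) (end₁ m e) (f e) (order m) (end₁<order e))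
                                     (sumBy-contrib (dir₂ e) (end₂ m e) (f e) (order m) (end₂<order e))) (allEdges m) ⟨
    sumBy (λ e → sumBy (c₁ e) vertices + sumBy (c₂ e) vertices) (allEdges m)
      ≡⟨ sumBy-cong (λ e → sumBy-+ (c₁ e) (c₂ e) vertices) (allEdges m) ⟨
    sumBy (λ e → sumBy (λ v → c₁ e v + c₂ e v) vertices) (allEdges m)
      ≡⟨ sumBy-comm (λ e v → c₁ e v + c₂ e v) (allEdges m) vertices ⟨
    sumBy (netOut m τ f) vertices ∎
    where
    open Orientation τ
    open ≡-Reasoning
    vertices = downFrom (order m)
    c₁ c₂ : Edge m → ℕ → ℤ
    c₁ e v = contrib (dir₁ e) (end₁ m e) v (f e)
    c₂ e v = contrib (dir₂ e) (end₂ m e) v (f e)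

  excess-positive : ∀ {σ} (τ : Orientation m σ) f e → σ e ≡ pos → excess τ f e ≡ 0
  excess-positive τ f e σe≡pos =
    opposite-halfEdgeValues (dir₁ e) (dir₂ e) (f e) (proj₁ (compatible e) σe≡pos)
    where open Orientation τ

  excess-negative : ∀ {σ} (τ : Orientation m σ) f e → σ e ≡ neg → excess τ f e ≡ 0 → f e ≡ 0
  excess-negative τ f e σe≡neg excess≡0 =
    equal-halfEdgeValues (dir₁ e) (f e) (subst (λ d → halfEdgeValue (dir₁ e) (f e) + halfEdgeValue d (f e) ≡ 0)
                                               (sym (proj₂ (compatible e) σe≡neg)) excess≡0)
    where open Orientation τ

  conservation-ℕ : ∀ {k σ} (F : NZFlow k m σ) v → v < order m →
                   netOut m (NZFlow.orientation F) (NZFlow.value F) v ≡ 0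
  conservation-ℕ F v v<order =
    subst (λ u → netOut m (NZFlow.orientation F) (NZFlow.value F) u ≡ 0) (toℕ-fromℕ< v<order)
          (NZFlow.conservation F (fromℕ< v<order))

  negativeEdges : Signature m → List (Edge m)
  negativeEdges σ = filter (negative? ∘ σ) (allEdges m)

  sumBy-excess-negativeEdges : ∀ {k σ} (F : NZFlow k m σ) →
                               sumBy (excess (NZFlow.orientation F) (NZFlow.value F)) (negativeEdges σ) ≡ 0
  sumBy-excess-negativeEdges {σ = σ} F = begin
    sumBy (excess orientation value) (negativeEdges σ)
      ≡⟨ sumBy-filter (negative? ∘ σ) (excess orientation value) nonnegative⇒excess≡0 (allEdges m) ⟨
    sumBy (excess orientation value) (allEdges m)            ≡⟨ handshake orientation value ⟩
    sumBy (netOut m orientation value) (downFrom (order m))  ≡⟨ sumBy-downFrom-zero (order m) (conservation-ℕ F) ⟩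
    0                                                        ∎
    where
    open NZFlow F
    open ≡-Reasoning
    nonnegative⇒excess≡0 : ∀ e → σ e ≢ neg → excess orientation value e ≡ 0
    nonnegative⇒excess≡0 e σe≢neg with σ e in σe
    ... | pos = excess-positive orientation value e σe
    ... | neg = ⊥-elim (σe≢neg refl)

  oneNegativeEdge⇒noFlow : ∀ {k σ e} → negativeEdges σ ≡ e ∷ [] → ¬ NZFlow k m σ
  oneNegativeEdge⇒noFlow {σ = σ} {e} negatives≡[e] F =
    nonzero e (excess-negative orientation value e σe≡neg (begin
      excess orientation value e                          ≡⟨ ℤₚ.+-identityʳ _ ⟨
      sumBy (excess orientation value) (e ∷ [])           ≡⟨ cong (sumBy (excess orientation value)) negatives≡[e] ⟨
      sumBy (excess orientation value) (negativeEdges σ)  ≡⟨ sumBy-excess-negativeEdges F ⟩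
      0                                                   ∎))
    where
    open NZFlow F
    open ≡-Reasoning
    σe≡neg : σ e ≡ neg
    σe≡neg = proj₂ (∈-filter⁻ (negative? ∘ σ) (subst (e ∈_) (sym negatives≡[e]) (here refl)))

  switchesToOneNegativeEdge⇒inadmissible : ∀ {σ e} s → negativeEdges (switch s σ) ≡ e ∷ [] → ¬ FlowAdmissible m σ
  switchesToOneNegativeEdge⇒inadmissible s negatives≡[e] (_ , F) = oneNegativeEdge⇒noFlow negatives≡[e] (switchFlow s F)

  lastVertex : ℕ
  lastVertex = m ℕ.+ suc m

  -- The first sign is that of the closing edge w_{2n}w_1, the others are those of the chords.
  canonical : Vec Sign (suc (suc m)) → Signature m
  canonical (c ∷ _)  (inj₁ j) = if does (j Fin.≟ fromℕ lastVertex) then c else pos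
  canonical (_ ∷ cs) (inj₂ j) = lookup cs j

  code : Signature m → Vec Sign (suc (suc m))
  code σ = σ (inj₁ (fromℕ lastVertex)) ∷ tabulate (σ ∘ inj₂)

  canonical-code : ∀ σ → (∀ j → j ≢ fromℕ lastVertex → σ (inj₁ j) ≡ pos) → σ ≗ canonical (code σ)
  canonical-code σ positive (inj₁ j) with j Fin.≟ fromℕ lastVertex
  ... | yes refl   = refl
  ... | no j≢last = positive j j≢last
  canonical-code σ _ (inj₂ j) = sym (lookup∘tabulate (σ ∘ inj₂) j)

  pathSwitch : Signature m → ℕ → Bool
  pathSwitch σ zero    = false
  pathSwitch σ (suc v) = pathSwitch σ v xor does (negative? (σ (inj₁ (v mod order m))))

  pathSwitch-positive : ∀ σ j → j ≢ fromℕ lastVertex → switch (pathSwitch σ) σ (inj₁ j) ≡ pos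
  pathSwitch-positive σ j j≢last = begin
    flipIf (s (toℕ j) xor s (suc (toℕ j) % order m)) (σ (inj₁ j))
      ≡⟨ cong (λ v → flipIf (s (toℕ j) xor s v) (σ (inj₁ j))) (m<n⇒m%n≡m (ℕ.s≤s j<last)) ⟩
    flipIf (s (toℕ j) xor (s (toℕ j) xor does (negative? (σ (inj₁ (toℕ j mod order m)))))) (σ (inj₁ j))
      ≡⟨ cong (λ b → flipIf b (σ (inj₁ j))) (xor-cancelˡ (s (toℕ j)) _) ⟩
    flipIf (does (negative? (σ (inj₁ (toℕ j mod order m))))) (σ (inj₁ j))
      ≡⟨ cong (λ i → flipIf (does (negative? (σ (inj₁ i)))) (σ (inj₁ j))) (toℕ-mod j) ⟩
    flipIf (does (negative? (σ (inj₁ j)))) (σ (inj₁ j))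
      ≡⟨ flipIf-negative (σ (inj₁ j)) ⟩
    pos ∎
    where
    open ≡-Reasoning
    s = pathSwitch σ
    j<last : toℕ j < lastVertex
    j<last = ≢fromℕ⇒toℕ< j j≢last

  reduceToCanonical : ∀ {k} → (∀ c → NZFlowOrInadmissible k m (canonical c)) →
                      ∀ σ → FlowAdmissible m σ → NZFlow k m σ
  reduceToCanonical settle σ (_ , F) =
    [ unswitchFlow s ∘ NZFlow-resp-≗ (sym ∘ σ′≗canonical)
    , (λ inadmissible → ⊥-elim (inadmissible (_ , NZFlow-resp-≗ σ′≗canonical (switchFlow s F)))) ]
    (settle (code σ′))
    where
    s = pathSwitch σ
    σ′ = switch s σ
    σ′≗canonical : σ′ ≗ canonical (code σ′)
    σ′≗canonical = canonical-code σ′ (pathSwitch-positive σ)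

  standardOrientation : (σ : Signature m) → Orientation m σ
  standardOrientation σ = record
    { dir₁ = λ _ → true
    ; dir₂ = λ e → does (negative? (σ e))
    ; compatible = λ e → xor⇒compatible (σ e) true _ (true-xor-negative (σ e)) }
    where
    true-xor-negative : ∀ x → true xor does (negative? x) ≡ isPositive x
    true-xor-negative pos = refl
    true-xor-negative neg = refl

  edgeFunction : {A : Set} → Vec A (order m) → Vec A (suc m) → Edge m → A
  edgeFunction cycleValues chordValues = [ lookup cycleValues , lookup chordValues ]

  allEdges? : {P : Edge m → Set} → Decidable P → Dec (∀ e → P e)
  allEdges? P? = map′ (λ (p , q) → [ p , q ]) (λ p → p ∘ inj₁ , p ∘ inj₂)
                      (Finₚ.all? (P? ∘ inj₁) ×-dec Finₚ.all? (P? ∘ inj₂))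

  nowhereZero? : (k : ℕ) (f : Edge m → ℤ) → Dec (∀ e → f e ≢ 0 × ∣ f e ∣ < k)
  nowhereZero? k f = allEdges? (λ e → ¬? (f e ℤ.≟ 0) ×-dec ∣ f e ∣ ℕ.<? k)

  conserved? : ∀ {σ} (τ : Orientation m σ) (f : Edge m → ℤ) → Dec (∀ (v : Fin (order m)) → netOut m τ f (toℕ v) ≡ 0)
  conserved? τ f = Finₚ.all? (λ v → netOut m τ f (toℕ v) ℤ.≟ 0)

  hasFlow : ∀ {k σ} (cycleValues : Vec ℤ (order m)) (chordValues : Vec ℤ (suc m)) →
            True (nowhereZero? k (edgeFunction cycleValues chordValues)) →
            True (conserved? (standardOrientation σ) (edgeFunction cycleValues chordValues)) →
            NZFlowOrInadmissible k m σ
  hasFlow cycleValues chordValues nowhereZero conserved = inj₁ (record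
    { orientation = standardOrientation _
    ; value = edgeFunction cycleValues chordValues
    ; nonzero = proj₁ ∘ toWitness nowhereZero
    ; bounded = proj₂ ∘ toWitness nowhereZero
    ; conservation = toWitness conserved })

  switchesToOneNegativeEdge : ∀ {k σ e} t → negativeEdges (switch (_<ᵇ t) σ) ≡ e ∷ [] → NZFlowOrInadmissible k m σ
  switchesToOneNegativeEdge t negatives≡[e] = inj₂ (switchesToOneNegativeEdge⇒inadmissible (_<ᵇ t) negatives≡[e])

fiveFlowOrInadmissible₄ : (c : Vec Sign 5) → NZFlowOrInadmissible 5 3 (canonical c)
fiveFlowOrInadmissible₄ (pos ∷ pos ∷ pos ∷ pos ∷ pos ∷ []) = hasFlow (-1 ∷ 3 ∷ 2 ∷ 4 ∷ 1 ∷ -3 ∷ -2 ∷ -4 ∷ []) (-3 ∷ -4 ∷ 1 ∷ -2 ∷ []) _ _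
fiveFlowOrInadmissible₄ (pos ∷ pos ∷ pos ∷ pos ∷ neg ∷ []) = switchesToOneNegativeEdge 0 refl
fiveFlowOrInadmissible₄ (pos ∷ pos ∷ pos ∷ neg ∷ pos ∷ []) = switchesToOneNegativeEdge 0 refl
fiveFlowOrInadmissible₄ (pos ∷ pos ∷ pos ∷ neg ∷ neg ∷ []) = hasFlow (-1 ∷ 2 ∷ 4 ∷ 2 ∷ -1 ∷ -4 ∷ -2 ∷ -4 ∷ []) (-3 ∷ -3 ∷ -2 ∷ 2 ∷ []) _ _
fiveFlowOrInadmissible₄ (pos ∷ pos ∷ neg ∷ pos ∷ pos ∷ []) = switchesToOneNegativeEdge 0 refl
fiveFlowOrInadmissible₄ (pos ∷ pos ∷ neg ∷ pos ∷ neg ∷ []) = hasFlow (-1 ∷ 2 ∷ 4 ∷ 1 ∷ -2 ∷ 1 ∷ -1 ∷ -4 ∷ []) (-3 ∷ -3 ∷ -2 ∷ 3 ∷ []) _ _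
fiveFlowOrInadmissible₄ (pos ∷ pos ∷ neg ∷ neg ∷ pos ∷ []) = hasFlow (-1 ∷ 3 ∷ -1 ∷ 2 ∷ -1 ∷ 3 ∷ -1 ∷ -4 ∷ []) (-3 ∷ -4 ∷ 4 ∷ -3 ∷ []) _ _
fiveFlowOrInadmissible₄ (pos ∷ pos ∷ neg ∷ neg ∷ neg ∷ []) = hasFlow (-1 ∷ 2 ∷ 1 ∷ -1 ∷ -4 ∷ -1 ∷ -2 ∷ -4 ∷ []) (-3 ∷ -3 ∷ 1 ∷ 2 ∷ []) _ _
fiveFlowOrInadmissible₄ (pos ∷ neg ∷ pos ∷ pos ∷ pos ∷ []) = switchesToOneNegativeEdge 0 refl
fiveFlowOrInadmissible₄ (pos ∷ neg ∷ pos ∷ pos ∷ neg ∷ []) = hasFlow (-1 ∷ 3 ∷ 2 ∷ -1 ∷ 2 ∷ -2 ∷ -1 ∷ -4 ∷ []) (-3 ∷ -4 ∷ 1 ∷ 3 ∷ []) _ _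
fiveFlowOrInadmissible₄ (pos ∷ neg ∷ pos ∷ neg ∷ pos ∷ []) = hasFlow (-1 ∷ 2 ∷ -1 ∷ 1 ∷ 4 ∷ 1 ∷ -2 ∷ -4 ∷ []) (-3 ∷ -3 ∷ 3 ∷ -2 ∷ []) _ _
fiveFlowOrInadmissible₄ (pos ∷ neg ∷ pos ∷ neg ∷ neg ∷ []) = hasFlow (-1 ∷ 2 ∷ 1 ∷ -1 ∷ 2 ∷ -1 ∷ -2 ∷ -4 ∷ []) (-3 ∷ -3 ∷ 1 ∷ 2 ∷ []) _ _
fiveFlowOrInadmissible₄ (pos ∷ neg ∷ neg ∷ pos ∷ pos ∷ []) = hasFlow (-1 ∷ -4 ∷ -1 ∷ 1 ∷ 4 ∷ 1 ∷ -2 ∷ -4 ∷ []) (-3 ∷ 3 ∷ -3 ∷ -2 ∷ []) _ _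
fiveFlowOrInadmissible₄ (pos ∷ neg ∷ neg ∷ pos ∷ neg ∷ []) = hasFlow (-1 ∷ -2 ∷ 1 ∷ -1 ∷ 2 ∷ 1 ∷ -2 ∷ -4 ∷ []) (-3 ∷ 1 ∷ -3 ∷ 2 ∷ []) _ _
fiveFlowOrInadmissible₄ (pos ∷ neg ∷ neg ∷ neg ∷ pos ∷ []) = hasFlow (-1 ∷ -2 ∷ -4 ∷ -1 ∷ 2 ∷ 1 ∷ -1 ∷ -4 ∷ []) (-3 ∷ 1 ∷ 2 ∷ -3 ∷ []) _ _
fiveFlowOrInadmissible₄ (pos ∷ neg ∷ neg ∷ neg ∷ neg ∷ []) = hasFlow (-1 ∷ 3 ∷ -1 ∷ -4 ∷ -1 ∷ 3 ∷ -1 ∷ -4 ∷ []) (-3 ∷ -4 ∷ 4 ∷ 3 ∷ []) _ _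
fiveFlowOrInadmissible₄ (neg ∷ pos ∷ pos ∷ pos ∷ pos ∷ []) = switchesToOneNegativeEdge 0 refl
fiveFlowOrInadmissible₄ (neg ∷ pos ∷ pos ∷ pos ∷ neg ∷ []) = switchesToOneNegativeEdge 7 refl
fiveFlowOrInadmissible₄ (neg ∷ pos ∷ pos ∷ neg ∷ pos ∷ []) = hasFlow (3 ∷ 2 ∷ -2 ∷ 1 ∷ 2 ∷ 3 ∷ -1 ∷ -4 ∷ []) (1 ∷ 1 ∷ 4 ∷ -3 ∷ []) _ _
fiveFlowOrInadmissible₄ (neg ∷ pos ∷ pos ∷ neg ∷ neg ∷ []) = switchesToOneNegativeEdge 6 refl
fiveFlowOrInadmissible₄ (neg ∷ pos ∷ neg ∷ pos ∷ pos ∷ []) = hasFlow (3 ∷ -1 ∷ 1 ∷ 2 ∷ 3 ∷ -1 ∷ -3 ∷ -4 ∷ []) (1 ∷ 4 ∷ -2 ∷ -1 ∷ []) _ _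
fiveFlowOrInadmissible₄ (neg ∷ pos ∷ neg ∷ pos ∷ neg ∷ []) = hasFlow (3 ∷ 2 ∷ 4 ∷ 1 ∷ 2 ∷ 1 ∷ -1 ∷ -4 ∷ []) (1 ∷ 1 ∷ -2 ∷ 3 ∷ []) _ _
fiveFlowOrInadmissible₄ (neg ∷ pos ∷ neg ∷ neg ∷ pos ∷ []) = hasFlow (3 ∷ 2 ∷ -1 ∷ 2 ∷ 3 ∷ 2 ∷ -1 ∷ -4 ∷ []) (1 ∷ 1 ∷ 3 ∷ -3 ∷ []) _ _
fiveFlowOrInadmissible₄ (neg ∷ pos ∷ neg ∷ neg ∷ neg ∷ []) = switchesToOneNegativeEdge 5 refl
fiveFlowOrInadmissible₄ (neg ∷ neg ∷ pos ∷ pos ∷ pos ∷ []) = switchesToOneNegativeEdge 1 refl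
fiveFlowOrInadmissible₄ (neg ∷ neg ∷ pos ∷ pos ∷ neg ∷ []) = hasFlow (3 ∷ 4 ∷ 2 ∷ -1 ∷ -2 ∷ -3 ∷ -1 ∷ -4 ∷ []) (1 ∷ -1 ∷ 2 ∷ 3 ∷ []) _ _
fiveFlowOrInadmissible₄ (neg ∷ neg ∷ pos ∷ neg ∷ pos ∷ []) = hasFlow (3 ∷ 4 ∷ 1 ∷ 4 ∷ 3 ∷ 2 ∷ -1 ∷ -4 ∷ []) (1 ∷ -1 ∷ 3 ∷ -3 ∷ []) _ _
fiveFlowOrInadmissible₄ (neg ∷ neg ∷ pos ∷ neg ∷ neg ∷ []) = hasFlow (3 ∷ 2 ∷ 1 ∷ -1 ∷ -2 ∷ -1 ∷ -2 ∷ -4 ∷ []) (1 ∷ 1 ∷ 1 ∷ 2 ∷ []) _ _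
fiveFlowOrInadmissible₄ (neg ∷ neg ∷ neg ∷ pos ∷ pos ∷ []) = switchesToOneNegativeEdge 2 refl
fiveFlowOrInadmissible₄ (neg ∷ neg ∷ neg ∷ pos ∷ neg ∷ []) = hasFlow (3 ∷ 2 ∷ 1 ∷ -1 ∷ -2 ∷ -3 ∷ -2 ∷ -4 ∷ []) (1 ∷ 1 ∷ 1 ∷ 2 ∷ []) _ _
fiveFlowOrInadmissible₄ (neg ∷ neg ∷ neg ∷ neg ∷ pos ∷ []) = switchesToOneNegativeEdge 3 refl
fiveFlowOrInadmissible₄ (neg ∷ neg ∷ neg ∷ neg ∷ neg ∷ []) = switchesToOneNegativeEdge 4 refl

fiveFlowOrInadmissible₅ : (c : Vec Sign 6) → NZFlowOrInadmissible 5 4 (canonical c)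
fiveFlowOrInadmissible₅ (pos ∷ pos ∷ pos ∷ pos ∷ pos ∷ pos ∷ []) = hasFlow (-1 ∷ 3 ∷ 4 ∷ 3 ∷ 4 ∷ 1 ∷ -3 ∷ -4 ∷ -3 ∷ -4 ∷ []) (-3 ∷ -4 ∷ -1 ∷ 1 ∷ -1 ∷ []) _ _
fiveFlowOrInadmissible₅ (pos ∷ pos ∷ pos ∷ pos ∷ pos ∷ neg ∷ []) = switchesToOneNegativeEdge 0 refl
fiveFlowOrInadmissible₅ (pos ∷ pos ∷ pos ∷ pos ∷ neg ∷ pos ∷ []) = switchesToOneNegativeEdge 0 refl
fiveFlowOrInadmissible₅ (pos ∷ pos ∷ pos ∷ pos ∷ neg ∷ neg ∷ []) = hasFlow (-1 ∷ 1 ∷ 2 ∷ 4 ∷ 2 ∷ -1 ∷ -3 ∷ -4 ∷ -2 ∷ -4 ∷ []) (-3 ∷ -2 ∷ -1 ∷ -2 ∷ 2 ∷ []) _ _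
fiveFlowOrInadmissible₅ (pos ∷ pos ∷ pos ∷ neg ∷ pos ∷ pos ∷ []) = switchesToOneNegativeEdge 0 refl
fiveFlowOrInadmissible₅ (pos ∷ pos ∷ pos ∷ neg ∷ pos ∷ neg ∷ []) = hasFlow (-1 ∷ 1 ∷ 3 ∷ 4 ∷ 2 ∷ -1 ∷ -3 ∷ -1 ∷ -2 ∷ -4 ∷ []) (-3 ∷ -2 ∷ -2 ∷ -1 ∷ 2 ∷ []) _ _
fiveFlowOrInadmissible₅ (pos ∷ pos ∷ pos ∷ neg ∷ neg ∷ pos ∷ []) = hasFlow (-1 ∷ 3 ∷ 4 ∷ 3 ∷ 4 ∷ 1 ∷ -3 ∷ -2 ∷ -3 ∷ -4 ∷ []) (-3 ∷ -4 ∷ -1 ∷ 1 ∷ -1 ∷ []) _ _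
fiveFlowOrInadmissible₅ (pos ∷ pos ∷ pos ∷ neg ∷ neg ∷ neg ∷ []) = hasFlow (-1 ∷ 2 ∷ 4 ∷ 3 ∷ 2 ∷ -1 ∷ -4 ∷ -2 ∷ -3 ∷ -4 ∷ []) (-3 ∷ -3 ∷ -2 ∷ 1 ∷ 1 ∷ []) _ _
fiveFlowOrInadmissible₅ (pos ∷ pos ∷ neg ∷ pos ∷ pos ∷ pos ∷ []) = switchesToOneNegativeEdge 0 refl
fiveFlowOrInadmissible₅ (pos ∷ pos ∷ neg ∷ pos ∷ pos ∷ neg ∷ []) = hasFlow (-1 ∷ 2 ∷ 4 ∷ 2 ∷ -1 ∷ -4 ∷ -1 ∷ -3 ∷ -1 ∷ -4 ∷ []) (-3 ∷ -3 ∷ -2 ∷ 2 ∷ 3 ∷ []) _ _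
fiveFlowOrInadmissible₅ (pos ∷ pos ∷ neg ∷ pos ∷ neg ∷ pos ∷ []) = hasFlow (-1 ∷ 3 ∷ 2 ∷ -2 ∷ 1 ∷ -2 ∷ 2 ∷ 3 ∷ -1 ∷ -4 ∷ []) (-3 ∷ -4 ∷ 1 ∷ 4 ∷ -3 ∷ []) _ _
fiveFlowOrInadmissible₅ (pos ∷ pos ∷ neg ∷ pos ∷ neg ∷ neg ∷ []) = hasFlow (-1 ∷ 2 ∷ 4 ∷ 3 ∷ 1 ∷ -2 ∷ 1 ∷ -1 ∷ -2 ∷ -4 ∷ []) (-3 ∷ -3 ∷ -2 ∷ 1 ∷ 2 ∷ []) _ _
fiveFlowOrInadmissible₅ (pos ∷ pos ∷ neg ∷ neg ∷ pos ∷ pos ∷ []) = hasFlow (-1 ∷ 3 ∷ -1 ∷ 1 ∷ 2 ∷ -1 ∷ 3 ∷ -1 ∷ -3 ∷ -4 ∷ []) (-3 ∷ -4 ∷ 4 ∷ -2 ∷ -1 ∷ []) _ _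
fiveFlowOrInadmissible₅ (pos ∷ pos ∷ neg ∷ neg ∷ pos ∷ neg ∷ []) = hasFlow (-1 ∷ 3 ∷ 2 ∷ 4 ∷ 1 ∷ -2 ∷ 2 ∷ 1 ∷ -1 ∷ -4 ∷ []) (-3 ∷ -4 ∷ 1 ∷ -2 ∷ 3 ∷ []) _ _
fiveFlowOrInadmissible₅ (pos ∷ pos ∷ neg ∷ neg ∷ neg ∷ pos ∷ []) = hasFlow (-1 ∷ 3 ∷ 2 ∷ -1 ∷ 2 ∷ -1 ∷ 3 ∷ 2 ∷ -1 ∷ -4 ∷ []) (-3 ∷ -4 ∷ 1 ∷ 3 ∷ -3 ∷ []) _ _
fiveFlowOrInadmissible₅ (pos ∷ pos ∷ neg ∷ neg ∷ neg ∷ neg ∷ []) = hasFlow (-1 ∷ 2 ∷ 4 ∷ 2 ∷ -1 ∷ -4 ∷ -1 ∷ 1 ∷ -1 ∷ -4 ∷ []) (-3 ∷ -3 ∷ -2 ∷ 2 ∷ 3 ∷ []) _ _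
fiveFlowOrInadmissible₅ (pos ∷ neg ∷ pos ∷ pos ∷ pos ∷ pos ∷ []) = switchesToOneNegativeEdge 0 refl
fiveFlowOrInadmissible₅ (pos ∷ neg ∷ pos ∷ pos ∷ pos ∷ neg ∷ []) = hasFlow (-1 ∷ 3 ∷ 4 ∷ 2 ∷ -1 ∷ 2 ∷ -2 ∷ -3 ∷ -1 ∷ -4 ∷ []) (-3 ∷ -4 ∷ -1 ∷ 2 ∷ 3 ∷ []) _ _
fiveFlowOrInadmissible₅ (pos ∷ neg ∷ pos ∷ pos ∷ neg ∷ pos ∷ []) = hasFlow (-1 ∷ 3 ∷ -1 ∷ -4 ∷ -1 ∷ 2 ∷ -2 ∷ 2 ∷ -1 ∷ -4 ∷ []) (-3 ∷ -4 ∷ 4 ∷ 3 ∷ -3 ∷ []) _ _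
fiveFlowOrInadmissible₅ (pos ∷ neg ∷ pos ∷ pos ∷ neg ∷ neg ∷ []) = hasFlow (-1 ∷ 3 ∷ 2 ∷ 1 ∷ -1 ∷ 2 ∷ -2 ∷ -1 ∷ -2 ∷ -4 ∷ []) (-3 ∷ -4 ∷ 1 ∷ 1 ∷ 2 ∷ []) _ _
fiveFlowOrInadmissible₅ (pos ∷ neg ∷ pos ∷ neg ∷ pos ∷ pos ∷ []) = hasFlow (-1 ∷ 2 ∷ -1 ∷ -2 ∷ 1 ∷ 4 ∷ 1 ∷ -2 ∷ -1 ∷ -4 ∷ []) (-3 ∷ -3 ∷ 3 ∷ 1 ∷ -3 ∷ []) _ _
fiveFlowOrInadmissible₅ (pos ∷ neg ∷ pos ∷ neg ∷ pos ∷ neg ∷ []) = hasFlow (-1 ∷ 3 ∷ 2 ∷ 1 ∷ -1 ∷ 2 ∷ -2 ∷ -3 ∷ -2 ∷ -4 ∷ []) (-3 ∷ -4 ∷ 1 ∷ 1 ∷ 2 ∷ []) _ _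
fiveFlowOrInadmissible₅ (pos ∷ neg ∷ pos ∷ neg ∷ neg ∷ pos ∷ []) = hasFlow (-1 ∷ 2 ∷ 3 ∷ -1 ∷ 1 ∷ 4 ∷ 1 ∷ 2 ∷ -2 ∷ -4 ∷ []) (-3 ∷ -3 ∷ -1 ∷ 4 ∷ -2 ∷ []) _ _
fiveFlowOrInadmissible₅ (pos ∷ neg ∷ pos ∷ neg ∷ neg ∷ neg ∷ []) = hasFlow (-1 ∷ 2 ∷ 4 ∷ 2 ∷ -1 ∷ 2 ∷ -1 ∷ 1 ∷ -1 ∷ -4 ∷ []) (-3 ∷ -3 ∷ -2 ∷ 2 ∷ 3 ∷ []) _ _
fiveFlowOrInadmissible₅ (pos ∷ neg ∷ neg ∷ pos ∷ pos ∷ pos ∷ []) = hasFlow (-1 ∷ -4 ∷ -1 ∷ -2 ∷ 1 ∷ 4 ∷ 1 ∷ -2 ∷ -1 ∷ -4 ∷ []) (-3 ∷ 3 ∷ -3 ∷ 1 ∷ -3 ∷ []) _ _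
fiveFlowOrInadmissible₅ (pos ∷ neg ∷ neg ∷ pos ∷ pos ∷ neg ∷ []) = hasFlow (-1 ∷ -2 ∷ 2 ∷ 3 ∷ 1 ∷ 4 ∷ 3 ∷ -1 ∷ -2 ∷ -4 ∷ []) (-3 ∷ 1 ∷ -4 ∷ -1 ∷ 2 ∷ []) _ _
fiveFlowOrInadmissible₅ (pos ∷ neg ∷ neg ∷ pos ∷ neg ∷ pos ∷ []) = hasFlow (-1 ∷ -3 ∷ -2 ∷ -3 ∷ -2 ∷ 1 ∷ -1 ∷ -2 ∷ -3 ∷ -4 ∷ []) (-3 ∷ 2 ∷ -1 ∷ 1 ∷ -1 ∷ []) _ _
fiveFlowOrInadmissible₅ (pos ∷ neg ∷ neg ∷ pos ∷ neg ∷ neg ∷ []) = hasFlow (-1 ∷ 2 ∷ 4 ∷ 1 ∷ -2 ∷ 1 ∷ 4 ∷ 2 ∷ -1 ∷ -4 ∷ []) (-3 ∷ -3 ∷ -2 ∷ 3 ∷ 3 ∷ []) _ _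
fiveFlowOrInadmissible₅ (pos ∷ neg ∷ neg ∷ neg ∷ pos ∷ pos ∷ []) = hasFlow (-1 ∷ -2 ∷ -4 ∷ -1 ∷ 1 ∷ 4 ∷ 3 ∷ 1 ∷ -2 ∷ -4 ∷ []) (-3 ∷ 1 ∷ 2 ∷ -3 ∷ -2 ∷ []) _ _
fiveFlowOrInadmissible₅ (pos ∷ neg ∷ neg ∷ neg ∷ pos ∷ neg ∷ []) = hasFlow (-1 ∷ 2 ∷ -1 ∷ 1 ∷ -2 ∷ 1 ∷ 4 ∷ 1 ∷ -1 ∷ -4 ∷ []) (-3 ∷ -3 ∷ 3 ∷ -2 ∷ 3 ∷ []) _ _
fiveFlowOrInadmissible₅ (pos ∷ neg ∷ neg ∷ neg ∷ neg ∷ pos ∷ []) = hasFlow (-1 ∷ 2 ∷ -1 ∷ -4 ∷ -2 ∷ 1 ∷ 4 ∷ 1 ∷ -2 ∷ -4 ∷ []) (-3 ∷ -3 ∷ 3 ∷ 3 ∷ -2 ∷ []) _ _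
fiveFlowOrInadmissible₅ (pos ∷ neg ∷ neg ∷ neg ∷ neg ∷ neg ∷ []) = hasFlow (-1 ∷ 3 ∷ 2 ∷ -1 ∷ -4 ∷ -1 ∷ 3 ∷ 2 ∷ -1 ∷ -4 ∷ []) (-3 ∷ -4 ∷ 1 ∷ 3 ∷ 3 ∷ []) _ _
fiveFlowOrInadmissible₅ (neg ∷ pos ∷ pos ∷ pos ∷ pos ∷ pos ∷ []) = switchesToOneNegativeEdge 0 refl
fiveFlowOrInadmissible₅ (neg ∷ pos ∷ pos ∷ pos ∷ pos ∷ neg ∷ []) = switchesToOneNegativeEdge 9 refl
fiveFlowOrInadmissible₅ (neg ∷ pos ∷ pos ∷ pos ∷ neg ∷ pos ∷ []) = hasFlow (3 ∷ 4 ∷ 3 ∷ -1 ∷ 2 ∷ 3 ∷ 2 ∷ 3 ∷ -1 ∷ -4 ∷ []) (1 ∷ -1 ∷ 1 ∷ 4 ∷ -3 ∷ []) _ _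
fiveFlowOrInadmissible₅ (neg ∷ pos ∷ pos ∷ pos ∷ neg ∷ neg ∷ []) = switchesToOneNegativeEdge 8 refl
fiveFlowOrInadmissible₅ (neg ∷ pos ∷ pos ∷ neg ∷ pos ∷ pos ∷ []) = hasFlow (3 ∷ 2 ∷ -2 ∷ -1 ∷ 1 ∷ 2 ∷ 3 ∷ -1 ∷ -2 ∷ -4 ∷ []) (1 ∷ 1 ∷ 4 ∷ -1 ∷ -2 ∷ []) _ _
fiveFlowOrInadmissible₅ (neg ∷ pos ∷ pos ∷ neg ∷ pos ∷ neg ∷ []) = hasFlow (3 ∷ 4 ∷ 3 ∷ 1 ∷ -2 ∷ -1 ∷ -2 ∷ -3 ∷ -1 ∷ -4 ∷ []) (1 ∷ -1 ∷ 1 ∷ 2 ∷ 3 ∷ []) _ _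
fiveFlowOrInadmissible₅ (neg ∷ pos ∷ pos ∷ neg ∷ neg ∷ pos ∷ []) = hasFlow (3 ∷ 2 ∷ 1 ∷ -2 ∷ 1 ∷ 2 ∷ 3 ∷ 2 ∷ -1 ∷ -4 ∷ []) (1 ∷ 1 ∷ 1 ∷ 3 ∷ -3 ∷ []) _ _
fiveFlowOrInadmissible₅ (neg ∷ pos ∷ pos ∷ neg ∷ neg ∷ neg ∷ []) = switchesToOneNegativeEdge 7 refl
fiveFlowOrInadmissible₅ (neg ∷ pos ∷ neg ∷ pos ∷ pos ∷ pos ∷ []) = hasFlow (3 ∷ -1 ∷ 2 ∷ 1 ∷ 2 ∷ 3 ∷ -1 ∷ -4 ∷ -3 ∷ -4 ∷ []) (1 ∷ 4 ∷ -3 ∷ 1 ∷ -1 ∷ []) _ _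
fiveFlowOrInadmissible₅ (neg ∷ pos ∷ neg ∷ pos ∷ pos ∷ neg ∷ []) = hasFlow (3 ∷ 2 ∷ 4 ∷ 1 ∷ -2 ∷ -1 ∷ -2 ∷ -4 ∷ -1 ∷ -4 ∷ []) (1 ∷ 1 ∷ -2 ∷ 3 ∷ 3 ∷ []) _ _
fiveFlowOrInadmissible₅ (neg ∷ pos ∷ neg ∷ pos ∷ neg ∷ pos ∷ []) = hasFlow (3 ∷ 2 ∷ 4 ∷ 1 ∷ 3 ∷ 4 ∷ 3 ∷ 1 ∷ -2 ∷ -4 ∷ []) (1 ∷ 1 ∷ -2 ∷ 3 ∷ -2 ∷ []) _ _
fiveFlowOrInadmissible₅ (neg ∷ pos ∷ neg ∷ pos ∷ neg ∷ neg ∷ []) = hasFlow (3 ∷ 4 ∷ 2 ∷ -1 ∷ -3 ∷ -2 ∷ -1 ∷ 1 ∷ -2 ∷ -4 ∷ []) (1 ∷ -1 ∷ 2 ∷ 3 ∷ 2 ∷ []) _ _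
fiveFlowOrInadmissible₅ (neg ∷ pos ∷ neg ∷ neg ∷ pos ∷ pos ∷ []) = hasFlow (3 ∷ 2 ∷ -1 ∷ 1 ∷ 2 ∷ 3 ∷ 2 ∷ -1 ∷ -3 ∷ -4 ∷ []) (1 ∷ 1 ∷ 3 ∷ -2 ∷ -1 ∷ []) _ _
fiveFlowOrInadmissible₅ (neg ∷ pos ∷ neg ∷ neg ∷ pos ∷ neg ∷ []) = hasFlow (3 ∷ 4 ∷ 2 ∷ 4 ∷ 1 ∷ 2 ∷ 3 ∷ 1 ∷ -1 ∷ -4 ∷ []) (1 ∷ -1 ∷ 2 ∷ -2 ∷ 3 ∷ []) _ _
fiveFlowOrInadmissible₅ (neg ∷ pos ∷ neg ∷ neg ∷ neg ∷ pos ∷ []) = hasFlow (3 ∷ 4 ∷ 3 ∷ -1 ∷ 2 ∷ 3 ∷ 4 ∷ 3 ∷ -1 ∷ -4 ∷ []) (1 ∷ -1 ∷ 1 ∷ 4 ∷ -3 ∷ []) _ _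
fiveFlowOrInadmissible₅ (neg ∷ pos ∷ neg ∷ neg ∷ neg ∷ neg ∷ []) = switchesToOneNegativeEdge 6 refl
fiveFlowOrInadmissible₅ (neg ∷ neg ∷ pos ∷ pos ∷ pos ∷ pos ∷ []) = switchesToOneNegativeEdge 1 refl
fiveFlowOrInadmissible₅ (neg ∷ neg ∷ pos ∷ pos ∷ pos ∷ neg ∷ []) = hasFlow (3 ∷ 4 ∷ 3 ∷ 2 ∷ -1 ∷ -2 ∷ -3 ∷ -2 ∷ -1 ∷ -4 ∷ []) (1 ∷ -1 ∷ 1 ∷ 1 ∷ 3 ∷ []) _ _
fiveFlowOrInadmissible₅ (neg ∷ neg ∷ pos ∷ pos ∷ neg ∷ pos ∷ []) = hasFlow (3 ∷ 2 ∷ 4 ∷ 1 ∷ 4 ∷ 3 ∷ 4 ∷ 2 ∷ -1 ∷ -4 ∷ []) (1 ∷ 1 ∷ -2 ∷ 3 ∷ -3 ∷ []) _ _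
fiveFlowOrInadmissible₅ (neg ∷ neg ∷ pos ∷ pos ∷ neg ∷ neg ∷ []) = hasFlow (3 ∷ 4 ∷ 2 ∷ 1 ∷ -1 ∷ -2 ∷ -3 ∷ -1 ∷ -2 ∷ -4 ∷ []) (1 ∷ -1 ∷ 2 ∷ 1 ∷ 2 ∷ []) _ _
fiveFlowOrInadmissible₅ (neg ∷ neg ∷ pos ∷ neg ∷ pos ∷ pos ∷ []) = hasFlow (3 ∷ 4 ∷ 1 ∷ 3 ∷ 4 ∷ 3 ∷ 2 ∷ -1 ∷ -3 ∷ -4 ∷ []) (1 ∷ -1 ∷ 3 ∷ -2 ∷ -1 ∷ []) _ _
fiveFlowOrInadmissible₅ (neg ∷ neg ∷ pos ∷ neg ∷ pos ∷ neg ∷ []) = hasFlow (3 ∷ 4 ∷ 3 ∷ 1 ∷ -1 ∷ -2 ∷ -3 ∷ -4 ∷ -2 ∷ -4 ∷ []) (1 ∷ -1 ∷ 1 ∷ 2 ∷ 2 ∷ []) _ _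
fiveFlowOrInadmissible₅ (neg ∷ neg ∷ pos ∷ neg ∷ neg ∷ pos ∷ []) = hasFlow (3 ∷ 4 ∷ 3 ∷ 1 ∷ 4 ∷ 3 ∷ 2 ∷ 1 ∷ -1 ∷ -4 ∷ []) (1 ∷ -1 ∷ 1 ∷ 2 ∷ -3 ∷ []) _ _
fiveFlowOrInadmissible₅ (neg ∷ neg ∷ pos ∷ neg ∷ neg ∷ neg ∷ []) = hasFlow (3 ∷ 2 ∷ 4 ∷ 2 ∷ -1 ∷ -2 ∷ -1 ∷ 1 ∷ -1 ∷ -4 ∷ []) (1 ∷ 1 ∷ -2 ∷ 2 ∷ 3 ∷ []) _ _
fiveFlowOrInadmissible₅ (neg ∷ neg ∷ neg ∷ pos ∷ pos ∷ pos ∷ []) = switchesToOneNegativeEdge 2 refl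
fiveFlowOrInadmissible₅ (neg ∷ neg ∷ neg ∷ pos ∷ pos ∷ neg ∷ []) = hasFlow (3 ∷ 2 ∷ 3 ∷ 1 ∷ -1 ∷ -2 ∷ -3 ∷ -4 ∷ -2 ∷ -4 ∷ []) (1 ∷ 1 ∷ -1 ∷ 2 ∷ 2 ∷ []) _ _
fiveFlowOrInadmissible₅ (neg ∷ neg ∷ neg ∷ pos ∷ neg ∷ pos ∷ []) = hasFlow (3 ∷ 4 ∷ 3 ∷ -1 ∷ 2 ∷ 1 ∷ 2 ∷ 3 ∷ -1 ∷ -4 ∷ []) (1 ∷ -1 ∷ 1 ∷ 4 ∷ -3 ∷ []) _ _
fiveFlowOrInadmissible₅ (neg ∷ neg ∷ neg ∷ pos ∷ neg ∷ neg ∷ []) = hasFlow (3 ∷ 2 ∷ 1 ∷ 2 ∷ -1 ∷ -2 ∷ -3 ∷ -2 ∷ -1 ∷ -4 ∷ []) (1 ∷ 1 ∷ 1 ∷ -1 ∷ 3 ∷ []) _ _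
fiveFlowOrInadmissible₅ (neg ∷ neg ∷ neg ∷ neg ∷ pos ∷ pos ∷ []) = switchesToOneNegativeEdge 3 refl
fiveFlowOrInadmissible₅ (neg ∷ neg ∷ neg ∷ neg ∷ pos ∷ neg ∷ []) = hasFlow (3 ∷ 4 ∷ 3 ∷ 2 ∷ -1 ∷ -2 ∷ -1 ∷ -2 ∷ -1 ∷ -4 ∷ []) (1 ∷ -1 ∷ 1 ∷ 1 ∷ 3 ∷ []) _ _
fiveFlowOrInadmissible₅ (neg ∷ neg ∷ neg ∷ neg ∷ neg ∷ pos ∷ []) = switchesToOneNegativeEdge 4 refl
fiveFlowOrInadmissible₅ (neg ∷ neg ∷ neg ∷ neg ∷ neg ∷ neg ∷ []) = switchesToOneNegativeEdge 5 refl

mainTheorem6 : ((σ : Signature 3) → FlowAdmissible 3 σ → NZFlow 5 3 σ)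
               × ((σ : Signature 4) → FlowAdmissible 4 σ → NZFlow 5 4 σ)
mainTheorem6 = reduceToCanonical fiveFlowOrInadmissible₄ , reduceToCanonical fiveFlowOrInadmissible₅
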